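{- Let $\alpha,\beta<\varepsilon_0$ and $k\geq2$, and suppose $F_\alpha(k)$ is defined with $K=F_\alpha(k)$. Suppose there is a step-down argument $s\vdash\beta+1\leq_k\alpha$. Then $k\leq F_\beta(k;K)$, and for every number $k'\leq F_\beta(k;K)$ we have $F_\beta(k';K)=F_\beta(k')<K$ (in particular $F_\beta(k')$ is defined).
   Context: Fundamental sequences (Buchholz–Wainer): $\{0\}(n)=0$, $\{\alpha+1\}(n)=\alpha$; for limit $\alpha=\gamma+\omega^{\delta}$ (Cantor normal form, $\delta>0$), $\{\alpha\}(n)=\gamma+\omega^{\delta'}\cdot(n+1)$ if $\delta=\delta'+1$, and $\{\alpha\}(n)=\gamma+\omega^{\{\delta\}(n)}$ if $\delta$ limit. Fast-growing hierarchy: $F_0(n)=n+1$, $F_{\alpha+1}(n)=F_\alpha^{n+1}(n)$, $F_\lambda(n)=F_{\{\lambda\}(n)}(n)$ (these are partial when formalized in weak arithmetic; "defined" means the value exists). $F_\alpha(n;K)$ is $F_\alpha(n)$ if $F_\alpha(n)$ is defined and $\leq K$, and $K$ otherwise. $\alpha$ meshes with $\gamma$ if $\alpha=0$ or $\gamma<\omega^{\alpha_0+1}$, $\alpha_0$ the smallest exponent of the Cantor normal form of $\alpha$. Step-down arguments are finite terms with top and bottom generated by: $\mathrm{fund}(m)$ (top $\beta$, bottom $\{\beta\}(m)$); $s*t$ (top of $t$, bottom of $s$, when top of $s$ = bottom of $t$); $\alpha+s$ (top $\alpha+\mathrm{top}(s)$, bottom $\alpha+\mathrm{bot}(s)$,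 when $\alpha$ meshes with $\mathrm{top}(s)$); $\omega^s$ (top $\omega^{\mathrm{top}(s)}$, bottom $\omega^{\mathrm{bot}(s)}$). The base of $s$ is the maximal $m$ with $\mathrm{fund}(m)$ in $s$; $s\vdash\gamma\leq_k\delta$ means top $\delta$, bottom $\gamma$, base $\leq k$. -}

module Defs where

open import Data.Nat using (ℕ; zero; suc; _≤_; _<_; _⊔_)
open import Data.Maybe using (Maybe; just; nothing)
open import Data.Product using (Σ; _×_)
open import Data.Sum using (_⊎_)
open import Relation.Binary.PropositionalEquality using (_≡_)
open import Relation.Nullary using (¬_)

-- Ordinal notations below ε₀ in Cantor normal form.
-- ω^ a + b  denotes  ω^a + b ;  a term is in normal form (NF) when the
-- exponents are non-increasing.

infixr 6 ω^_+_
data OT : Set where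
  𝟎     : OT
  ω^_+_ : OT → OT → OT

data Cmp : Set where
  lt eq gt : Cmp

-- lexicographic comparison (correct on normal forms)
cmp : OT → OT → Cmp
cmp 𝟎 𝟎 = eq
cmp 𝟎 (ω^ _ + _) = lt
cmp (ω^ _ + _) 𝟎 = gt
cmp (ω^ a + b) (ω^ c + d) with cmp a c
... | lt = lt
... | gt = gt
... | eq = cmp b d

_<ₒ_ : OT → OT → Set
a <ₒ b = cmp a b ≡ lt

_≤ₒ_ : OT → OT → Set
a ≤ₒ b = (a <ₒ b) ⊎ (a ≡ b)

data NF : OT → Set where
  nf𝟎 : NF 𝟎
  nf1 : ∀ {a} → NF a → NF (ω^ a + 𝟎)
  nf2 : ∀ {a c d} → NF a → NF (ω^ c + d) → c ≤ₒ a → NF (ω^ a + ω^ c + d)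

one : OT
one = ω^ 𝟎 + 𝟎

infixl 5 _⊕_
_⊕_ : OT → OT → OT
𝟎 ⊕ b = b
(ω^ a + c) ⊕ 𝟎 = ω^ a + c
(ω^ a + c) ⊕ (ω^ d + e) with cmp a d
... | lt = ω^ d + e
... | _  = ω^ a + (c ⊕ (ω^ d + e))

-- smallest exponent of the Cantor normal form of a nonzero ordinal
-- (returns 𝟎 for 𝟎; only used for nonzero arguments)
lastExp : OT → OT
lastExp 𝟎 = 𝟎
lastExp (ω^ a + 𝟎) = a
lastExp (ω^ a + (ω^ c + d)) = lastExp (ω^ c + d)

Meshes : OT → OT → Set
Meshes α γ = (α ≡ 𝟎) ⊎ (γ <ₒ (ω^ (lastExp α ⊕ one) + 𝟎))

-- predecessor: just β if α = β + 1, nothing if α is 0 or a limit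
pred? : OT → Maybe OT
pred? 𝟎 = nothing
pred? (ω^ 𝟎 + 𝟎) = just 𝟎
pred? (ω^ (ω^ _ + _) + 𝟎) = nothing
pred? (ω^ a + (ω^ c + d)) with pred? (ω^ c + d)
... | just p  = just (ω^ a + p)
... | nothing = nothing

rep : ℕ → OT → OT
rep zero e = 𝟎
rep (suc m) e = ω^ e + rep m e

-- Buchholz–Wainer fundamental sequences {α}(n)
-- (fundω δ p n  is {ω^δ}(n) for δ > 0, given p = pred? δ)
fundωAux : Maybe OT → OT → ℕ → OT
fundωAux (just δ') fδ n = rep (suc n) δ'
fundωAux nothing   fδ n = ω^ fδ + 𝟎

fund : OT → ℕ → OT
fund 𝟎 n = 𝟎
fund (ω^ a + (ω^ c + d)) n = ω^ a + fund (ω^ c + d) n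
fund (ω^ 𝟎 + 𝟎) n = 𝟎
fund (ω^ (ω^ a + b) + 𝟎) n = fundωAux (pred? (ω^ a + b)) (fund (ω^ a + b) n) n

-- Fast-growing hierarchy as a graph (partial function):
-- F α n v  means "F_α(n) is defined and equals v".

mutual
  data F : OT → ℕ → ℕ → Set where
    F-zero : ∀ {n} → F 𝟎 n (suc n)
    F-succ : ∀ {α β n v} → pred? α ≡ just β → Iter β (suc n) n v → F α n v
    F-lim  : ∀ {a b n v} → pred? (ω^ a + b) ≡ nothing →
             F (fund (ω^ a + b) n) n v → F (ω^ a + b) n v

  -- Iter β m x y : F_β^m(x) is defined and equals y
  data Iter (β : OT) : ℕ → ℕ → ℕ → Set where
    it-zero : ∀ {x} → Iter β zero x x
    it-suc  : ∀ {m x y z} → F β x y → Iter β m y z → Iter β (suc m) x z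

-- F_β(n;K) = w  : F_β(n) if defined and ≤ K, and K otherwise
data FK (β : OT) (n K : ℕ) : ℕ → Set where
  fk-def : ∀ {v} → F β n v → v ≤ K → FK β n K v
  fk-cap : ¬ (Σ ℕ λ v → F β n v × v ≤ K) → FK β n K K

-- Step-down arguments, indexed by bottom, top and base:
-- Step γ δ m : a step-down argument with bottom γ, top δ and base m.
-- The base is the maximum m of the fund(m) occurring in the term.

data Step : OT → OT → ℕ → Set where
  fundS : ∀ β m → NF β → Step (fund β m) β m
  _*S_  : ∀ {γ δ ε m m'} → Step γ δ m → Step δ ε m' → Step γ ε (m ⊔ m')
  plusS : ∀ α {γ δ m} → NF α → Meshes α δ → Step γ δ m → Step (α ⊕ γ) (α ⊕ δ) m
  omegaS : ∀ {γ δ m} → Step γ δ m → Step (ω^ γ + 𝟎) (ω^ δ + 𝟎) m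

_⊢_≤[_]_ : ∀ {γ δ m} → Step γ δ m → OT → ℕ → OT → Set
_⊢_≤[_]_ {γ} {δ} {m} s γ' k δ' = (γ ≡ γ') × (δ ≡ δ') × (m ≤ k)

module Submission where

-- A step-down argument γ ≤_k δ is unfolded into a k-descent δ ⇝[ k ] γ: a
-- finite sequence of steps x ↦ {x}(m) with m ≤ k.  Descents are closed under
-- x ↦ ω^a + x, x ↦ ω^x and (for meshing α) x ↦ α + x, and every ordinal
-- 0-descends to 0; together these give the Bachmann property
-- {λ}(n) ⇝[ 0 ] {λ}(m) for m ≤ n.  From it follow the two monotonicity
-- properties of the fast-growing hierarchy used here: F_δ(k) = v and
-- δ ⇝[ k ] γ imply F_γ(k) ≤ v, and F_β(n) = v, m ≤ n imply F_β(m) ≤ v.  The theorem then reads off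
-- F_{β+1}(k) = F_β^{k+1}(k) ≤ K, i.e. (as k ≥ 2) F_β(k) < F_β²(k) < F_β³(k) ≤ K,
-- and bounds F_β(k') ≤ F_β²(k') for k' ≤ F_β(k) by monotonicity.

open import Defs
open import Data.Nat using (ℕ; zero; suc; _≤_; _<_; z≤n; s≤s; _≤′_; ≤′-refl; ≤′-step)
open import Data.Nat.Properties using (≤-refl; ≤-trans; <⇒≤; m≤m⊔n; m≤n⊔m; <-≤-trans; ≤-<-trans; ≤⇒≤′)
open import Data.Product using (Σ; _×_; _,_; proj₁; proj₂)
open import Data.Sum using (_⊎_; inj₁; inj₂)
open import Data.Maybe using (just; nothing)
import Data.Maybe as Maybe
open import Data.Maybe.Properties using (just-injective)
open import Data.Empty using (⊥-elim)
open import Data.Unit using (⊤; tt)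
open import Relation.Nullary using (¬_)
open import Relation.Binary.PropositionalEquality using (_≡_; refl; sym; trans; cong; cong₂; subst; subst₂)
open import Relation.Binary.Construct.Closure.ReflexiveTransitive using (Star; ε; _◅_; _◅◅_)
import Relation.Binary.Construct.Closure.ReflexiveTransitive as Star

infix 4 _≺_ _≼_
data _≺_ : OT → OT → Set where
  𝟎≺ω^   : ∀ {a b} → 𝟎 ≺ (ω^ a + b)
  ≺-head : ∀ {a b c d} → a ≺ c → (ω^ a + b) ≺ (ω^ c + d)
  ≺-tail : ∀ {a b d} → b ≺ d → (ω^ a + b) ≺ (ω^ a + d)

_≼_ : OT → OT → Set
a ≼ b = (a ≺ b) ⊎ (a ≡ b)

cmp-eq : ∀ a b → cmp a b ≡ eq → a ≡ b
cmp-eq 𝟎 𝟎 _ = refl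
cmp-eq (ω^ a + b) (ω^ c + d) h with cmp a c in e | h
... | eq | b≡d = cong₂ ω^_+_ (cmp-eq a c e) (cmp-eq b d b≡d)

-- `cmp` is sound for the lexicographic order; this transports the hypotheses
-- of NF and Meshes (stated with _<ₒ_) to _≺_.
<ₒ⇒≺ : ∀ a b → a <ₒ b → a ≺ b
<ₒ⇒≺ 𝟎 (ω^ _ + _) _ = 𝟎≺ω^
<ₒ⇒≺ (ω^ a + b) (ω^ c + d) h with cmp a c in e | h
... | lt | _ = ≺-head (<ₒ⇒≺ a c e)
... | eq | b<d with cmp-eq a c e
... | refl = ≺-tail (<ₒ⇒≺ b d b<d)

≤ₒ⇒≼ : ∀ {a b} → a ≤ₒ b → a ≼ b
≤ₒ⇒≼ {a} {b} (inj₁ a<b) = inj₁ (<ₒ⇒≺ a b a<b)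
≤ₒ⇒≼ (inj₂ a≡b) = inj₂ a≡b

≺-irrefl : ∀ {a} → ¬ (a ≺ a)
≺-irrefl (≺-head a<a) = ≺-irrefl a<a
≺-irrefl (≺-tail b<b) = ≺-irrefl b<b

≺-trans : ∀ {a b c} → a ≺ b → b ≺ c → a ≺ c
≺-trans 𝟎≺ω^ (≺-head _) = 𝟎≺ω^
≺-trans 𝟎≺ω^ (≺-tail _) = 𝟎≺ω^
≺-trans (≺-head p) (≺-head q) = ≺-head (≺-trans p q)
≺-trans (≺-head p) (≺-tail _) = ≺-head p
≺-trans (≺-tail _) (≺-head q) = ≺-head q
≺-trans (≺-tail p) (≺-tail q) = ≺-tail (≺-trans p q)

≼-trans : ∀ {a b c} → a ≼ b → b ≼ c → a ≼ c
≼-trans (inj₁ p) (inj₁ q) = inj₁ (≺-trans p q)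
≼-trans p (inj₂ refl) = p
≼-trans (inj₂ refl) q = q

≼⇒⊁ : ∀ {a b} → a ≼ b → ¬ (b ≺ a)
≼⇒⊁ (inj₁ a<b) b<a = ≺-irrefl (≺-trans a<b b<a)
≼⇒⊁ (inj₂ refl) = ≺-irrefl

⊕-one : ∀ a c → (ω^ a + c) ⊕ one ≡ ω^ a + (c ⊕ one)
⊕-one 𝟎 c = refl
⊕-one (ω^ _ + _) c = refl

⊕-𝟎 : ∀ α → α ⊕ 𝟎 ≡ α
⊕-𝟎 𝟎 = refl
⊕-𝟎 (ω^ _ + _) = refl

pred?-cons : ∀ a c d → pred? (ω^ a + ω^ c + d) ≡ Maybe.map (ω^ a +_) (pred? (ω^ c + d))
pred?-cons 𝟎 c d with pred? (ω^ c + d)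
... | just _ = refl
... | nothing = refl
pred?-cons (ω^ _ + _) c d with pred? (ω^ c + d)
... | just _ = refl
... | nothing = refl

pred?-tail-just : ∀ a c d {y} → pred? (ω^ a + ω^ c + d) ≡ just y →
  Σ OT λ p → pred? (ω^ c + d) ≡ just p × y ≡ ω^ a + p
pred?-tail-just a c d h with pred? (ω^ c + d) | pred?-cons a c d
... | just p | e = p , refl , just-injective (trans (sym h) e)
... | nothing | e with trans (sym h) e
... | ()

pred?-tail-nothing : ∀ a c d → pred? (ω^ a + ω^ c + d) ≡ nothing → pred? (ω^ c + d) ≡ nothing
pred?-tail-nothing a c d h with pred? (ω^ c + d) | pred?-cons a c d
... | nothing | _ = refl
... | just _ | e with trans (sym h) e
... | ()

pred?-succ : ∀ β → pred? (β ⊕ one) ≡ just β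
pred?-succ 𝟎 = refl
pred?-succ (ω^ a + c) rewrite ⊕-one a c with c ⊕ one | pred?-succ c
... | ω^ x + y | e = trans (pred?-cons a x y) (cong (Maybe.map (ω^ a +_)) e)

≺succ⇒≼ : ∀ y {x} → x ≺ (y ⊕ one) → x ≼ y
≺succ⇒≼ 𝟎 𝟎≺ω^ = inj₂ refl
≺succ⇒≼ 𝟎 (≺-head ())
≺succ⇒≼ 𝟎 (≺-tail ())
≺succ⇒≼ (ω^ a + c) h = below (subst (_ ≺_) (⊕-one a c) h)
  where
  below : ∀ {x} → x ≺ (ω^ a + (c ⊕ one)) → x ≼ (ω^ a + c)
  below 𝟎≺ω^ = inj₁ 𝟎≺ω^
  below (≺-head d<a) = inj₁ (≺-head d<a)
  below (≺-tail e<c+1) with ≺succ⇒≼ c e<c+1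
  ... | inj₁ e<c = inj₁ (≺-tail e<c)
  ... | inj₂ refl = inj₂ refl

predecessor : ∀ x {y} → pred? x ≡ just y → (∀ n → fund x n ≡ y) × y ≺ x
predecessor 𝟎 ()
predecessor (ω^ 𝟎 + 𝟎) refl = (λ _ → refl) , 𝟎≺ω^
predecessor (ω^ (ω^ _ + _) + 𝟎) ()
predecessor (ω^ a + ω^ c + d) h with pred?-tail-just a c d h
... | p , e , refl with predecessor (ω^ c + d) e
... | fund≡p , p< = (λ n → cong (ω^ a +_) (fund≡p n)) , ≺-tail p<

fund-ω^-succ : ∀ a b {p} m → pred? (ω^ a + b) ≡ just p → fund (ω^ (ω^ a + b) + 𝟎) m ≡ rep (suc m) p
fund-ω^-succ a b m e rewrite e = refl

fund-ω^-lim : ∀ a b m → pred? (ω^ a + b) ≡ nothing → fund (ω^ (ω^ a + b) + 𝟎) m ≡ ω^ fund (ω^ a + b) m + 𝟎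
fund-ω^-lim a b m e rewrite e = refl

fund-ω^-0 : ∀ a b → fund (ω^ (ω^ a + b) + 𝟎) 0 ≡ ω^ fund (ω^ a + b) 0 + 𝟎
fund-ω^-0 a b with pred? (ω^ a + b) in e
... | just _ = cong (λ z → ω^ z + 𝟎) (sym (proj₁ (predecessor (ω^ a + b) e) 0))
... | nothing = refl

fund< : ∀ a b m → fund (ω^ a + b) m ≺ (ω^ a + b)
fund< a (ω^ c + d) m = ≺-tail (fund< c d m)
fund< 𝟎 𝟎 m = 𝟎≺ω^
fund< (ω^ a + b) 𝟎 m with pred? (ω^ a + b) in e
... | just _ = ≺-head (proj₂ (predecessor (ω^ a + b) e))
... | nothing = ≺-head (fund< a b m)

fund≤ : ∀ x m → fund x m ≼ x
fund≤ 𝟎 m = inj₂ refl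
fund≤ (ω^ a + b) m = inj₁ (fund< a b m)

data FundStep (k : ℕ) (x : OT) : OT → Set where
  fund-step : ∀ m → m ≤ k → FundStep k x (fund x m)

_⇝[_]_ : OT → ℕ → OT → Set
x ⇝[ k ] y = Star (FundStep k) x y

step-to : ∀ {k x y z} m → m ≤ k → fund x m ≡ y → y ⇝[ k ] z → x ⇝[ k ] z
step-to m p refl c = fund-step m p ◅ c

weaken : ∀ {k k' x y} → k ≤ k' → x ⇝[ k ] y → x ⇝[ k' ] y
weaken k≤k' = Star.map λ { (fund-step m p) → fund-step m (≤-trans p k≤k') }

descent≤ : ∀ {k x y} → x ⇝[ k ] y → y ≼ x
descent≤ ε = inj₂ refl
descent≤ (fund-step m _ ◅ c) = ≼-trans (descent≤ c) (fund≤ _ m)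

head-lift : ∀ {k x y} a → x ⇝[ k ] y → (ω^ a + x) ⇝[ k ] (ω^ a + y)
head-lift a ε = ε
head-lift {x = 𝟎} a (fund-step m p ◅ c) = head-lift a c
head-lift {x = ω^ _ + _} a (fund-step m p ◅ c) = fund-step m p ◅ head-lift a c

omega-lift₀ : ∀ {x y} → x ⇝[ 0 ] y → (ω^ x + 𝟎) ⇝[ 0 ] (ω^ y + 𝟎)
omega-lift₀ ε = ε
omega-lift₀ {x = 𝟎} (fund-step 0 z≤n ◅ c) = omega-lift₀ c
omega-lift₀ {x = ω^ a + b} (fund-step 0 z≤n ◅ c) = step-to 0 z≤n (fund-ω^-0 a b) (omega-lift₀ c)

to-𝟎 : ∀ x → x ⇝[ 0 ] 𝟎
to-𝟎 𝟎 = ε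
to-𝟎 (ω^ a + b) = head-lift a (to-𝟎 b) ◅◅ omega-lift₀ (to-𝟎 a) ◅◅ fund-step 0 z≤n ◅ ε

drop-copy : ∀ n p → rep (suc n) p ⇝[ 0 ] rep n p
drop-copy zero p = to-𝟎 (ω^ p + 𝟎)
drop-copy (suc n) p = head-lift p (drop-copy n p)

-- Descents lift through x ↦ ω^x.  At a successor exponent q + 1 the step
-- {ω^{q+1}}(m) = ω^q·(m+1) is followed by a 0-descent down to ω^q.
omega-lift : ∀ {k x y} → x ⇝[ k ] y → (ω^ x + 𝟎) ⇝[ k ] (ω^ y + 𝟎)
omega-lift ε = ε
omega-lift {x = 𝟎} (fund-step m p ◅ c) = omega-lift c
omega-lift {k} {ω^ a + b} {y} (fund-step m p ◅ c) with pred? (ω^ a + b) in e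
... | just q = step-to m p (fund-ω^-succ a b m e)
  (head-lift q (weaken z≤n (to-𝟎 (rep m q))) ◅◅
   subst (λ z → (ω^ z + 𝟎) ⇝[ k ] (ω^ y + 𝟎)) (proj₁ (predecessor (ω^ a + b) e) m) (omega-lift c))
... | nothing = step-to m p (fund-ω^-lim a b m e) (omega-lift c)

bachmann-step : ∀ a b j → pred? (ω^ a + b) ≡ nothing →
  fund (ω^ a + b) (suc j) ⇝[ 0 ] fund (ω^ a + b) j
bachmann-step a (ω^ c + d) j h = head-lift a (bachmann-step c d j (pred?-tail-nothing a c d h))
bachmann-step 𝟎 𝟎 j ()
bachmann-step (ω^ a + b) 𝟎 j h with pred? (ω^ a + b) in e
... | just p = drop-copy (suc j) p
... | nothing = omega-lift₀ (bachmann-step a b j e)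

bachmann : ∀ a b {m n} → pred? (ω^ a + b) ≡ nothing → m ≤ n →
  fund (ω^ a + b) n ⇝[ 0 ] fund (ω^ a + b) m
bachmann a b h m≤n = along (≤⇒≤′ m≤n)
  where
  along : ∀ {m n} → m ≤′ n → fund (ω^ a + b) n ⇝[ 0 ] fund (ω^ a + b) m
  along ≤′-refl = ε
  along (≤′-step q) = bachmann-step a b _ h ◅◅ along q

mutual
  F-inflationary : ∀ {β n v} → F β n v → n < v
  F-inflationary F-zero = ≤-refl
  F-inflationary (F-succ _ (it-suc d rest)) = <-≤-trans (F-inflationary d) (Iter-inflationary rest)
  F-inflationary (F-lim _ d) = F-inflationary d

  Iter-inflationary : ∀ {β j x y} → Iter β j x y → x ≤ y
  Iter-inflationary it-zero = ≤-refl
  Iter-inflationary (it-suc d rest) = ≤-trans (<⇒≤ (F-inflationary d)) (Iter-inflationary rest)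

F-succ⁻¹ : ∀ {x β n v} → F x n v → pred? x ≡ just β → Iter β (suc n) n v
F-succ⁻¹ F-zero ()
F-succ⁻¹ (F-succ e it) h with trans (sym e) h
... | refl = it
F-succ⁻¹ (F-lim e _) h with trans (sym e) h
... | ()

F-descend : ∀ {δ γ k v} → F δ k v → δ ⇝[ k ] γ → Σ ℕ λ u → F γ k u × u ≤ v
F-descend d ε = _ , d , ≤-refl
F-descend d@F-zero (fund-step m p ◅ c) = F-descend d c
F-descend {δ} {γ} {k} (F-succ e (it-suc d rest)) (fund-step m p ◅ c)
  with F-descend d (subst (λ z → z ⇝[ k ] γ) (proj₁ (predecessor δ e) m) c)
... | u , du , u≤ = u , du , ≤-trans u≤ (Iter-inflationary rest)
F-descend (F-lim {a} {b} e d) (fund-step m p ◅ c) = F-descend d (weaken z≤n (bachmann a b e p) ◅◅ c)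

mutual
  F-mono : ∀ {β n v m} → F β n v → m ≤ n → Σ ℕ λ u → F β m u × u ≤ v
  F-mono F-zero m≤n = _ , F-zero , s≤s m≤n
  F-mono (F-succ e it) m≤n with Iter-mono it (s≤s m≤n) m≤n
  ... | u , it' , u≤v = u , F-succ e it' , u≤v
  F-mono (F-lim {a} {b} e d) m≤n with F-mono d m≤n
  ... | u₁ , d₁ , u₁≤v with F-descend d₁ (weaken z≤n (bachmann a b e m≤n))
  ... | u , du , u≤u₁ = u , F-lim e du , ≤-trans u≤u₁ u₁≤v

  Iter-mono : ∀ {β j x y j' x'} → Iter β j x y → j' ≤ j → x' ≤ x →
    Σ ℕ λ y' → Iter β j' x' y' × y' ≤ y
  Iter-mono it-zero z≤n x'≤x = _ , it-zero , x'≤x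
  Iter-mono it@(it-suc _ _) z≤n x'≤x = _ , it-zero , ≤-trans x'≤x (Iter-inflationary it)
  Iter-mono (it-suc d rest) (s≤s j'≤j) x'≤x with F-mono d x'≤x
  ... | z' , d' , z'≤z with Iter-mono rest j'≤j z'≤z
  ... | y' , rest' , y'≤y = y' , it-suc d' rest' , y'≤y

infixr 5 _⊞_
_⊞_ : OT → OT → OT
𝟎 ⊞ x = x
(ω^ a + c) ⊞ x = ω^ a + (c ⊞ x)

⊞-𝟎 : ∀ c → c ⊞ 𝟎 ≡ c
⊞-𝟎 𝟎 = refl
⊞-𝟎 (ω^ a + c) = cong (ω^ a +_) (⊞-𝟎 c)

⊞-lift : ∀ α {k x y} → x ⇝[ k ] y → (α ⊞ x) ⇝[ k ] (α ⊞ y)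
⊞-lift 𝟎 c = c
⊞-lift (ω^ a + α) c = head-lift a (⊞-lift α c)

LeadAtMost : OT → OT → Set
LeadAtMost a 𝟎 = ⊤
LeadAtMost a (ω^ d + _) = d ≼ a

lead-mono : ∀ {a x y} → y ≼ x → LeadAtMost a x → LeadAtMost a y
lead-mono (inj₁ 𝟎≺ω^) _ = tt
lead-mono (inj₁ (≺-head d<c)) c≤a = ≼-trans (inj₁ d<c) c≤a
lead-mono (inj₁ (≺-tail _)) c≤a = c≤a
lead-mono (inj₂ refl) h = h

lastExp≤lead : ∀ {c d} → NF (ω^ c + d) → lastExp (ω^ c + d) ≼ c
lastExp≤lead (nf1 _) = inj₂ refl
lastExp≤lead (nf2 _ nf c'≤c) = ≼-trans (lastExp≤lead nf) (≤ₒ⇒≼ c'≤c)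

⊕-concat : ∀ {α} x → NF α → LeadAtMost (lastExp α) x → α ⊕ x ≡ α ⊞ x
⊕-concat {α} 𝟎 _ _ = trans (⊕-𝟎 α) (sym (⊞-𝟎 α))
⊕-concat (ω^ _ + _) nf𝟎 _ = refl
⊕-concat (ω^ d + f) (nf1 {a} _) d≤a with cmp a d in e
... | lt = ⊥-elim (≼⇒⊁ d≤a (<ₒ⇒≺ a d e))
... | eq = refl
... | gt = refl
⊕-concat (ω^ d + f) (nf2 {a} _ nf c≤a) d≤last with cmp a d in e
... | lt = ⊥-elim (≼⇒⊁ (≼-trans d≤last (≼-trans (lastExp≤lead nf) (≤ₒ⇒≼ c≤a))) (<ₒ⇒≺ a d e))
... | eq = cong (ω^ a +_) (⊕-concat (ω^ d + f) nf d≤last)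
... | gt = cong (ω^ a +_) (⊕-concat (ω^ d + f) nf d≤last)

below-ω^succ : ∀ a {x} → x ≺ (ω^ (a ⊕ one) + 𝟎) → LeadAtMost a x
below-ω^succ a 𝟎≺ω^ = tt
below-ω^succ a (≺-head d<a+1) = ≺succ⇒≼ a d<a+1
below-ω^succ a (≺-tail ())

mesh-⊕ : ∀ {α δ γ} → NF α → Meshes α δ → γ ≼ δ → α ⊕ γ ≡ α ⊞ γ
mesh-⊕ _ (inj₁ refl) _ = refl
mesh-⊕ {α} {δ} {γ} nf (inj₂ δ<) γ≤δ = ⊕-concat γ nf (lead-mono γ≤δ (below-ω^succ (lastExp α) (<ₒ⇒≺ δ _ δ<)))

step-down⇒descent : ∀ {γ δ j k} → Step γ δ j → j ≤ k → δ ⇝[ k ] γ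
step-down⇒descent (fundS β m _) m≤k = fund-step m m≤k ◅ ε
step-down⇒descent (_*S_ {m = m} {m' = m'} s₁ s₂) j≤k =
  step-down⇒descent s₂ (≤-trans (m≤n⊔m m m') j≤k) ◅◅ step-down⇒descent s₁ (≤-trans (m≤m⊔n m m') j≤k)
step-down⇒descent {k = k} (plusS α nf mesh s) j≤k =
  subst₂ (_⇝[ k ]_) (sym (mesh-⊕ nf mesh (inj₂ refl))) (sym (mesh-⊕ nf mesh (descent≤ c))) (⊞-lift α c)
  where
  c = step-down⇒descent s j≤k
step-down⇒descent (omegaS s) j≤k = omega-lift (step-down⇒descent s j≤k)

lemma3p9 : ∀ (α β : OT) (k K : ℕ) → NF α → NF β → 2 ≤ k → F α k K →
    (Σ OT λ γ → Σ OT λ δ → Σ ℕ λ m → Σ (Step γ δ m) λ s → s ⊢ β ⊕ one ≤[ k ] α) →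
    Σ ℕ λ w → FK β k K w × k ≤ w ×
      (∀ k' → k' ≤ w → Σ ℕ λ v → F β k' v × FK β k' K v × v < K)
lemma3p9 α β k K _ _ (s≤s (s≤s z≤n)) Fα (_ , _ , m , s , refl , refl , m≤k)
  with F-descend Fα (step-down⇒descent s m≤k)
... | u , Fβ+1 , u≤K with F-succ⁻¹ Fβ+1 (pred?-succ β)
... | it-suc {y = y₁} F₁ (it-suc {y = y₂} F₂ (it-suc F₃ rest)) =
  y₁ , fk-def F₁ (<⇒≤ y₁<K) , <⇒≤ (F-inflationary F₁) , bounded
  where
  -- F_β(k) < F_β²(k) < F_β³(k) ≤ F_{β+1}(k) ≤ K
  y₂<K : y₂ < K
  y₂<K = <-≤-trans (F-inflationary F₃) (≤-trans (Iter-inflationary rest) u≤K)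
  y₁<K : y₁ < K
  y₁<K = <-≤-trans (F-inflationary F₂) (<⇒≤ y₂<K)
  -- F_β(k') ≤ F_β(y₁) = y₂ for k' ≤ y₁
  bounded : ∀ k' → k' ≤ y₁ → Σ ℕ λ v → F β k' v × FK β k' K v × v < K
  bounded k' k'≤y₁ with F-mono F₂ k'≤y₁
  ... | v , Fv , v≤y₂ = v , Fv , fk-def Fv (<⇒≤ v<K) , v<K
    where
    v<K : v < K
    v<K = ≤-<-trans v≤y₂ y₂<K
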